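{- Let $G$ be a finite group, let $a\ge 2$ be an integer, and let $H_1, \dots, H_n$ be subgroups of $G$ such that $H_i \cap H_j = \{e\}$ for all $i \ne j$, where $e$ is the identity of $G$. Then $$N(a, G) \ge \sum_{i=1}^n N(a, H_i) - n + 1.$$
   Context: For a finite group $H$ and integer $a\ge 2$, $G(a,H)$ is the undirected multigraph on vertex set $H$ with an edge between $x$ and $y$ whenever $x^a=y$ (an additional edge if also $y^a=x$; loops allowed), and $N(a,H)$ is its number of connected components, equivalently the number of cycles of the map $x\mapsto x^a$ on $H$. -}

module Defs where

open import Data.Nat using (ℕ; zero; suc)
open import Data.Fin using (Fin)
open import Data.Product using (Σ; ∃; _×_)
open import Data.Sum using (_⊎_)
open import Function.Bundles using (_↔_)
open import Algebra.Core using (Op₁; Op₂)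
open import Algebra.Structures using (IsGroup)
open import Relation.Binary.PropositionalEquality using (_≡_)
open import Relation.Binary.Construct.Closure.ReflexiveTransitive using (Star)

record FiniteGroup : Set₁ where
  field
    Carrier : Set
    _∙_     : Op₂ Carrier
    e       : Carrier
    _⁻¹     : Op₁ Carrier
    isGroup : IsGroup _≡_ _∙_ e _⁻¹
    size    : ℕ
    enum    : Carrier ↔ Fin size

  pow : Carrier → ℕ → Carrier
  pow x zero    = e
  pow x (suc n) = x ∙ pow x n

open FiniteGroup public

record Subgroup (G : FiniteGroup) : Set₁ where
  field
    mem     : Carrier G → Set
    e-mem   : mem (e G)
    ∙-mem   : ∀ {x y} → mem x → mem y → mem (_∙_ G x y)
    ⁻¹-mem  : ∀ {x} → mem x → mem (_⁻¹ G x)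

open Subgroup public

whole : (G : FiniteGroup) → Subgroup G
whole G = record { mem = λ _ → ⊤' ; e-mem = tt' ; ∙-mem = λ _ _ → tt' ; ⁻¹-mem = λ _ → tt' }
  where
  open import Data.Unit using () renaming (⊤ to ⊤'; tt to tt')

-- Edge relation of the multigraph G(a,H) on vertex set H:
-- x — y whenever x^a = y or y^a = x (multiplicity is irrelevant for connectivity).
Edge : (G : FiniteGroup) (a : ℕ) (H : Subgroup G) → Carrier G → Carrier G → Set
Edge G a H x y = mem H x × mem H y × (pow G x a ≡ y ⊎ pow G y a ≡ x)

Connected : (G : FiniteGroup) (a : ℕ) (H : Subgroup G) → Carrier G → Carrier G → Set
Connected G a H = Star (Edge G a H)

-- N(a,H) = k : G(a,H) has exactly k connected components, i.e. there are
-- k vertices of H, pairwise in distinct components, meeting every component.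
IsN : (G : FiniteGroup) (a : ℕ) (H : Subgroup G) (k : ℕ) → Set
IsN G a H k =
  Σ (Fin k → Carrier G) λ r →
    (∀ i → mem H (r i)) ×
    (∀ i j → Connected G a H (r i) (r j) → i ≡ j) ×
    (∀ x → mem H x → ∃ λ i → Connected G a H x (r i))

-- Each component of G(a,Hᵢ) lies inside a component of G(a,G), and no two
-- components of the same G(a,Hᵢ) land in the same one: in a functional graph
-- connected vertices have a common iterate, and the iterates of a vertex of Hᵢ
-- stay in Hᵢ. Components of different Hᵢ, Hⱼ can meet only at a common iterate,
-- which lies in Hᵢ ∩ Hⱼ = {e}, i.e. only in the component of e. So the
-- components of all the G(a,Hᵢ) inject into the N(a,G) − 1 components of G(a,G)
-- other than that of e, plus at most one per Hᵢ.
module Submission where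

open import Defs
open import Data.Nat using (ℕ; zero; suc; _+_; _≤_; s≤s)
open import Data.Nat.Properties using (+-comm)
open import Data.Nat.GeneralisedArithmetic using (iterate)
open import Data.Nat.ListAction using (sum)
open import Data.Fin using (Fin; zero; suc; splitAt; join; punchOut; _↑ˡ_; _↑ʳ_; _≟_)
open import Data.Fin.Properties
  using (injective⇒≤; punchOut-injective; splitAt⁻¹-↑ˡ; splitAt⁻¹-↑ʳ; splitAt-join)
open import Data.List using (tabulate)
open import Data.Product using (Σ; ∃₂; _×_; _,_; proj₁; proj₂)
open import Data.Sum using (_⊎_; inj₁; inj₂)
open import Data.Sum.Properties using (inj₁-injective; inj₂-injective)
open import Data.Unit using (tt)
open import Function.Base using (_∘_)
open import Function.Definitions using (Injective)
open import Relation.Nullary using (yes; no; contradiction)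
open import Relation.Binary.PropositionalEquality
  using (_≡_; _≢_; refl; sym; trans; cong; subst; module ≡-Reasoning)
open import Relation.Binary.Construct.Closure.ReflexiveTransitive
  using (Star; ε; _◅_; _◅◅_; reverse)

Blocks : (n : ℕ) → (Fin n → ℕ) → Set
Blocks n B = Σ (Fin n) (λ i → Fin (B i))

fromSum : ∀ {n} (B : Fin n → ℕ) → Fin (sum (tabulate B)) → Blocks n B
fromSum {suc n} B k with splitAt (B zero) k
... | inj₁ j  = zero , j
... | inj₂ k′ = let (i , j) = fromSum (B ∘ suc) k′ in suc i , j

toSum : ∀ {n} (B : Fin n → ℕ) → Blocks n B → Fin (sum (tabulate B))
toSum {suc n} B (zero  , j) = j ↑ˡ _
toSum {suc n} B (suc i , j) = B zero ↑ʳ toSum (B ∘ suc) (i , j)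

toSum-fromSum : ∀ {n} (B : Fin n → ℕ) (k : Fin (sum (tabulate B))) → toSum B (fromSum B k) ≡ k
toSum-fromSum {suc n} B k with splitAt (B zero) k in eq
... | inj₁ j  = splitAt⁻¹-↑ˡ eq
... | inj₂ k′ = trans (cong (B zero ↑ʳ_) (toSum-fromSum (B ∘ suc) k′)) (splitAt⁻¹-↑ʳ eq)

fromSum-injective : ∀ {n} (B : Fin n → ℕ) → Injective _≡_ _≡_ (fromSum B)
fromSum-injective B {k} {k′} eq = begin
  k                      ≡⟨ sym (toSum-fromSum B k) ⟩
  toSum B (fromSum B k)  ≡⟨ cong (toSum B) eq ⟩
  toSum B (fromSum B k′) ≡⟨ toSum-fromSum B k′ ⟩
  k′                     ∎
  where open ≡-Reasoning

blocks-injective⇒sum≤ : ∀ {n M} {B : Fin n → ℕ} (g : Blocks n B → Fin M) → Injective _≡_ _≡_ g →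
                         sum (tabulate B) ≤ M
blocks-injective⇒sum≤ {B = B} g g-inj = injective⇒≤ {f = g ∘ fromSum B} (fromSum-injective B ∘ g-inj)

join-injective : ∀ m n → Injective _≡_ _≡_ (join m n)
join-injective m n {u} {v} eq = begin
  u                        ≡⟨ sym (splitAt-join m n u) ⟩
  splitAt m (join m n u)   ≡⟨ cong (splitAt m) eq ⟩
  splitAt m (join m n v)   ≡⟨ splitAt-join m n v ⟩
  v                        ∎
  where open ≡-Reasoning

-- κ is injective away from c and hits c at most once per block, so sending (i , j)
-- to punchOut c (κ (i , j)), or to i when κ (i , j) = c, injects into Fin (N − 1) ⊎ Fin n.
blockwise-injective⇒sum+1≤ :
  ∀ {n N} {B : Fin n → ℕ} (κ : Blocks n B → Fin N) (c : Fin N) →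
  (∀ {i} j j′ → κ (i , j) ≡ κ (i , j′) → j ≡ j′) →
  (∀ {i i′} j j′ → i ≢ i′ → κ (i , j) ≡ κ (i′ , j′) → κ (i , j) ≡ c) →
  sum (tabulate B) + 1 ≤ N + n
blockwise-injective⇒sum+1≤ {n} {suc N} {B} κ c inBlock across =
  subst (_≤ suc (N + n)) (+-comm 1 (sum (tabulate B)))
        (s≤s (blocks-injective⇒sum≤ (join N n ∘ code) (code-injective ∘ join-injective N n)))
  where
  code : Blocks n B → Fin N ⊎ Fin n
  code (i , j) with κ (i , j) ≟ c
  ... | yes _   = inj₂ i
  ... | no κ≢c = inj₁ (punchOut (κ≢c ∘ sym))

  same-block : ∀ {i i′ j j′} → i ≡ i′ → κ (i , j) ≡ κ (i′ , j′) → (i , j) ≡ (i′ , j′)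
  same-block {i} refl eq = cong (i ,_) (inBlock _ _ eq)

  code-injective : Injective _≡_ _≡_ code
  code-injective {i , j} {i′ , j′} eq with κ (i , j) ≟ c | κ (i′ , j′) ≟ c
  code-injective eq | yes κ≡c | yes κ′≡c = same-block (inj₂-injective eq) (trans κ≡c (sym κ′≡c))
  code-injective () | yes _   | no _
  code-injective () | no _    | yes _
  code-injective {i , j} {i′ , j′} eq | no κ≢c | no κ′≢c
    with punchOut-injective (κ≢c ∘ sym) (κ′≢c ∘ sym) (inj₁-injective eq) | i ≟ i′
  ... | κ≡κ′ | yes i≡i′ = same-block i≡i′ κ≡κ′
  ... | κ≡κ′ | no i≢i′  = contradiction (across j j′ i≢i′ κ≡κ′) κ≢c

iterate-suc : ∀ {A : Set} (f : A → A) x k → iterate f x (suc k) ≡ f (iterate f x k)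
iterate-suc f x zero    = refl
iterate-suc f x (suc k) = iterate-suc f (f x) k

module FunctionalGraph {A : Set} (f : A → A) (P : A → Set) where

  Adjacent : A → A → Set
  Adjacent x y = P x × P y × (f x ≡ y ⊎ f y ≡ x)

  Path : A → A → Set
  Path = Star Adjacent

  Path-sym : ∀ {x y} → Path x y → Path y x
  Path-sym = reverse λ where
    (Px , Py , inj₁ fx≡y) → Py , Px , inj₂ fx≡y
    (Px , Py , inj₂ fy≡x) → Py , Px , inj₁ fy≡x

  path⇒common-iterate : ∀ {x y} → Path x y → ∃₂ λ k m → iterate f x k ≡ iterate f y m
  path⇒common-iterate ε = 0 , 0 , refl
  path⇒common-iterate ((_ , _ , inj₁ fx≡y) ◅ y~z) with path⇒common-iterate y~z
  ... | k , m , eq = suc k , m , trans (cong (λ w → iterate f w k) fx≡y) eq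
  path⇒common-iterate {x} (_◅_ {j = y} (_ , _ , inj₂ fy≡x) y~z) with path⇒common-iterate y~z
  ... | k , m , eq = k , suc m , (begin
    iterate f x k       ≡⟨ cong (λ w → iterate f w k) fy≡x ⟨
    iterate f y (suc k) ≡⟨ iterate-suc f y k ⟩
    f (iterate f y k)   ≡⟨ cong f eq ⟩
    f (iterate f _ m)   ≡⟨ iterate-suc f _ m ⟨
    iterate f _ (suc m) ∎)
    where open ≡-Reasoning

  module _ (P-closed : ∀ {x} → P x → P (f x)) where

    iterate-closed : ∀ {x} k → P x → P (iterate f x k)
    iterate-closed zero    Px = Px
    iterate-closed (suc k) Px = iterate-closed k (P-closed Px)

    path-to-iterate : ∀ {x} k → P x → Path x (iterate f x k)
    path-to-iterate zero    Px = ε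
    path-to-iterate (suc k) Px = (Px , P-closed Px , inj₁ refl) ◅ path-to-iterate k (P-closed Px)

    common-iterate⇒path : ∀ {x y} → P x → P y → ∃₂ (λ k m → iterate f x k ≡ iterate f y m) → Path x y
    common-iterate⇒path Px Py (k , m , eq) =
      subst (Path _) eq (path-to-iterate k Px) ◅◅ Path-sym (path-to-iterate m Py)

module _ {G : FiniteGroup} (a : ℕ) where

  private
    module Graph (H : Subgroup G) = FunctionalGraph (λ x → pow G x a) (mem H)

  pow-closed : ∀ (H : Subgroup G) {x} n → mem H x → mem H (pow G x n)
  pow-closed H zero    Hx = e-mem H
  pow-closed H (suc n) Hx = ∙-mem H Hx (pow-closed H n Hx)

  connected-restrict : ∀ (H K : Subgroup G) {x y} → mem H x → mem H y →
                       Connected G a K x y → Connected G a H x y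
  connected-restrict H K Hx Hy x~y =
    Graph.common-iterate⇒path H (pow-closed H a) Hx Hy (Graph.path⇒common-iterate K x~y)

  connected-across⇒connected-to-e :
    ∀ (H K : Subgroup G) → (∀ x → mem H x → mem K x → x ≡ e G) →
    ∀ {x y} → mem H x → mem K y → Connected G a (whole G) x y → Connected G a (whole G) x (e G)
  connected-across⇒connected-to-e H K H∩K⊆e {x} Hx Ky x~y
    with Graph.path⇒common-iterate (whole G) x~y
  ... | k , m , eq = subst (Connected G a (whole G) x) common-iterate≡e
                           (Graph.path-to-iterate (whole G) _ k tt)
    where
    common-iterate≡e : iterate (λ z → pow G z a) x k ≡ e G
    common-iterate≡e = H∩K⊆e _ (Graph.iterate-closed H (pow-closed H a) k Hx)
                                (subst (mem K) (sym eq) (Graph.iterate-closed K (pow-closed K a) m Ky))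

  module Components {H : Subgroup G} {N : ℕ} (isN : IsN G a H N) where

    component : ∀ x → mem H x → Fin N
    component x Hx = proj₁ (proj₂ (proj₂ (proj₂ isN)) x Hx)

    private
      representative : Fin N → Carrier G
      representative = proj₁ isN

      connected-representative : ∀ x (Hx : mem H x) → Connected G a H x (representative (component x Hx))
      connected-representative x Hx = proj₂ (proj₂ (proj₂ (proj₂ isN)) x Hx)

    connected⇒component≡ : ∀ {x y} (Hx : mem H x) (Hy : mem H y) →
                           Connected G a H x y → component x Hx ≡ component y Hy
    connected⇒component≡ Hx Hy x~y = proj₁ (proj₂ (proj₂ isN)) _ _
      (Graph.Path-sym H (connected-representative _ Hx) ◅◅ x~y ◅◅ connected-representative _ Hy)

    component≡⇒connected : ∀ {x y} (Hx : mem H x) (Hy : mem H y) →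
                           component x Hx ≡ component y Hy → Connected G a H x y
    component≡⇒connected {x} Hx Hy eq =
      subst (Connected G a H x ∘ representative) eq (connected-representative x Hx)
      ◅◅ Graph.Path-sym H (connected-representative _ Hy)

-- The bound holds for every exponent.
lemma2p2 : (G : FiniteGroup) (a : ℕ) → 2 ≤ a →
           (n : ℕ) (H : Fin n → Subgroup G) →
           (∀ i j → i ≢ j → ∀ x → mem (H i) x → mem (H j) x → x ≡ e G) →
           (NG : ℕ) → IsN G a (whole G) NG →
           (NH : Fin n → ℕ) → (∀ i → IsN G a (H i) (NH i)) →
           sum (tabulate NH) + 1 ≤ NG + n
lemma2p2 G a _ n H Hᵢ∩Hⱼ⊆e NG isN NH isNᵢ =
  blockwise-injective⇒sum+1≤ κ (component (e G) tt) same-subgroup different-subgroups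
  where
  open Components a isN

  r : ∀ i → Fin (NH i) → Carrier G
  r i = proj₁ (isNᵢ i)

  r∈H : ∀ i j → mem (H i) (r i j)
  r∈H i = proj₁ (proj₂ (isNᵢ i))

  r-separates : ∀ i j j′ → Connected G a (H i) (r i j) (r i j′) → j ≡ j′
  r-separates i = proj₁ (proj₂ (proj₂ (isNᵢ i)))

  κ : Blocks n NH → Fin NG
  κ (i , j) = component (r i j) tt

  same-subgroup : ∀ {i} j j′ → κ (i , j) ≡ κ (i , j′) → j ≡ j′
  same-subgroup {i} j j′ eq = r-separates i j j′
    (connected-restrict a (H i) (whole G) (r∈H i j) (r∈H i j′) (component≡⇒connected tt tt eq))

  different-subgroups : ∀ {i i′} j j′ → i ≢ i′ → κ (i , j) ≡ κ (i′ , j′) → κ (i , j) ≡ component (e G) tt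
  different-subgroups {i} {i′} j j′ i≢i′ eq = connected⇒component≡ tt tt
    (connected-across⇒connected-to-e a (H i) (H i′) (Hᵢ∩Hⱼ⊆e i i′ i≢i′) (r∈H i j) (r∈H i′ j′)
      (component≡⇒connected tt tt eq))
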